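{- Let $d\in\mathbb{N}_{+}$, $\delta>0$, let $p\gg_{d}\delta^{ -O_{d}(1)}$ be a prime, and let $A$ be a $d\times d$ matrix over $\mathbb{F}_{p}$ of rank at least $3$. Let $B$ be a $d\times d$ matrix over $\mathbb{F}_{p}$, $v\in\mathbb{F}_{p}^{d}$, and $W\subseteq\mathbb{F}_{p}^{d}$ with $|W|\geq\delta p^{d}$. Suppose that for all $w\in W$ and $n\in\mathbb{F}_{p}^{d}$ with $(nA)\cdot w=0$ we have $(nB+v)\cdot w=0$. Then $v=\mathbf{0}$ and $B=cA$ for some $c\in\mathbb{F}_{p}$.
   Context: Vectors are row vectors; $nA$ is the row vector times matrix product and $\cdot$ is the dot product in $\mathbb{F}_p^d$. "$p\gg_d\delta^{ -O_d(1)}$" means $p\ge K\delta^{ -K}$ for a sufficiently large constant $K$ depending only on $d$.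
   Formalization: The parameter δ ranges over the positive rationals. -}

module Defs where

open import Data.Nat as ℕ using (ℕ; zero; suc; NonZero)
open import Data.Nat.DivMod using (_mod_)
open import Data.Fin using (Fin; toℕ)
open import Data.Integer using (+_)
open import Data.Rational as ℚ using (ℚ; 1ℚ)
open import Data.Product using (Σ; _×_; _,_)
open import Relation.Binary.PropositionalEquality using (_≡_)

𝔽 : ℕ → Set
𝔽 p = Fin p

module Field (p : ℕ) .{{_ : NonZero p}} where

  0F : 𝔽 p
  0F = 0 mod p

  _+F_ : 𝔽 p → 𝔽 p → 𝔽 p
  a +F b = (toℕ a ℕ.+ toℕ b) mod p

  _*F_ : 𝔽 p → 𝔽 p → 𝔽 p
  a *F b = (toℕ a ℕ.* toℕ b) mod p

  Σ[_] : (d : ℕ) → (Fin d → 𝔽 p) → 𝔽 p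
  Σ[ zero ] f = 0F
  Σ[ suc d ] f = f Fin.zero +F Σ[ d ] (λ i → f (Fin.suc i))

  Vect : ℕ → Set
  Vect d = Fin d → 𝔽 p

  Mat : ℕ → Set
  Mat d = Fin d → Fin d → 𝔽 p

  _·_ : {d : ℕ} → Vect d → Vect d → 𝔽 p
  _·_ {d} x y = Σ[ d ] (λ i → x i *F y i)

  _⊛_ : {d : ℕ} → Vect d → Mat d → Vect d
  _⊛_ {d} n A j = Σ[ d ] (λ i → n i *F A i j)

  _⊕_ : {d : ℕ} → Vect d → Vect d → Vect d
  (x ⊕ y) i = x i +F y i

  -- rank A ≥ r : A has r linearly independent rows (row rank ≥ r), i.e.
  -- there are row indices ι₁,…,ι_r such that Σ_k c_k A_{ι_k} = 0 forces c = 0.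
  RankAtLeast : {d : ℕ} → ℕ → Mat d → Set
  RankAtLeast {d} r A =
    Σ (Fin r → Fin d) λ ι →
      (c : Fin r → 𝔽 p) →
      ((j : Fin d) → Σ[ r ] (λ k → c k *F A (ι k) j) ≡ 0F) →
      (k : Fin r) → c k ≡ 0F

_^ℚ_ : ℚ → ℕ → ℚ
q ^ℚ zero = 1ℚ
q ^ℚ suc n = q ℚ.* (q ^ℚ n)

⟦_⟧ : ℕ → ℚ
⟦ n ⟧ = (+ n) ℚ./ 1

{-# OPTIONS --safe #-}
-- For w ∈ W let α = A w and β = B w, reading w as a column vector. The hypothesis says that
-- every n with n · α = 0 satisfies n · β + v · w = 0. Taking n = 0 gives v · w = 0, and then
-- β is a multiple μ α, so w lies in the kernel of B − μ A for some μ.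
-- If v ≠ 0, then W lies in the hyperplane v^⊥, which has p^(d-1) points. If B is not a multiple
-- of A, fix a nonzero 2 × 2 minor of A (rank ≥ 2 suffices). The same minor of B − μ A is a
-- quadratic in μ whose leading coefficient is that minor, so it vanishes for at most two μ.
-- Where it does not vanish, a point of ker (B − μ A) is determined by μ and its coordinates
-- outside the two columns of the minor; at the (at most two) roots, it is determined by its
-- coordinates outside a column in which B − μ A has a nonzero entry. Hence |W| ≤ 3 p^(d-1).
-- Since |W| ≤ p^d forces δ ≤ 1, the condition δ^4 p ≥ 4 gives δ p ≥ 4, so δ p^d ≤ |W| rules
-- out both bounds.
module Submission where

open import Defs
open import Data.Nat using (ℕ; NonZero; _≤_; _^_)
open import Data.Nat.Primality using (Prime)
open import Data.Fin using (Fin)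
open import Data.Vec using (Vec; lookup)
open import Data.List using (List; length)
open import Data.List.Membership.Propositional using (_∈_)
open import Data.List.Relation.Unary.Unique.Propositional using (Unique)
open import Data.Rational as ℚ using (ℚ; 0ℚ)
open import Data.Product using (Σ; ∃-syntax; _×_)
open import Relation.Binary.PropositionalEquality using (_≡_)

open import Algebra.Bundles using (CommutativeMonoid; CommutativeRing)
open import Algebra.Structures using (IsCommutativeRing)
open import Data.Fin as Fin using (zero; suc; toℕ; punchIn; punchOut)
open import Data.Fin.Properties as Fin
  using ( _≟_; toℕ-injective; toℕ-fromℕ<; toℕ<n; punchInᵢ≢i; punchIn-injective; punchIn-punchOut
        ; punchOut-injective; injective⇒≤; any?; all?; ¬∀⟶∃¬; combine-injective )
import Data.List as List
open import Data.List.Membership.Propositional.Properties using (∈-lookup)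
import Data.List.Relation.Unary.All as All
open import Data.List.Relation.Unary.AllPairs using (_∷_)
import Data.Maybe
open import Data.Nat using (zero; suc)
import Data.Nat as ℕ
import Data.Nat.Properties as ℕ
open import Data.Nat.DivMod using (_mod_; _%_; %-distribˡ-+; %-distribˡ-*; m<n⇒m%n≡m; n%n≡0)
open import Data.Nat.Divisibility using (_∣_; m%n≡0⇒n∣m; n∣m⇒m%n≡0)
open import Data.Nat.Primality using (euclidsLemma; prime⇒nonTrivial)
open import Data.Product using (_,_; proj₁; proj₂; ∃)
import Data.Sign as Sign
open import Data.Sum using (_⊎_; inj₁; inj₂)
import Data.Sum
open import Data.Unit using (⊤)
open import Data.Vec.Functional as Vector using (Vector; removeAt; replicate)
import Data.Vec.Properties as Vec
open import Function using (_∘_; Injective)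
open import Level using (_⊔_)
open import Relation.Binary.Consequences using (dec⇒weaklyDec)
open import Relation.Binary.Definitions using (tri<; tri≈; tri>)
open import Relation.Binary.PropositionalEquality using (_≢_; _≗_)
import Relation.Binary.PropositionalEquality as ≡
open import Relation.Nullary using (¬_; yes; no; contradiction)
open import Relation.Nullary.Decidable using (_×-dec_)

module CommutativeMonoidSum {a ℓ} (M : CommutativeMonoid a ℓ) where
  open CommutativeMonoid M
    using (Carrier; _≈_; setoid; ∙-congˡ; identityʳ) renaming (_∙_ to _+_; ε to 0#)
  open import Algebra.Properties.CommutativeMonoid.Sum M
    using (sum; sum-remove; sum-cong-≋; sum-replicate-zero)
  open import Relation.Binary.Reasoning.Setoid setoid

  sum-single : ∀ {n} {k : Fin n} (f : Vector Carrier n) →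
               (∀ j → k ≢ j → f j ≈ 0#) → sum f ≈ f k
  sum-single {suc n} {k} f f≈0 = begin
    sum f                       ≈⟨ sum-remove {i = k} f ⟩
    f k + sum (removeAt f k)    ≈⟨ ∙-congˡ (sum-cong-≋ vanishes) ⟩
    f k + sum (replicate n 0#)  ≈⟨ ∙-congˡ (sum-replicate-zero n) ⟩
    f k + 0#                    ≈⟨ identityʳ (f k) ⟩
    f k                         ∎
    where
    vanishes : ∀ j → f (punchIn k j) ≈ 0#
    vanishes j = f≈0 (punchIn k j) (punchInᵢ≢i k j ∘ ≡.sym)

  sum-pair : ∀ {n} {k l : Fin n} → k ≢ l → (f : Vector Carrier n) →
             (∀ j → k ≢ j → l ≢ j → f j ≈ 0#) → sum f ≈ f k + f l
  sum-pair {suc n} {k} {l} k≢l f f≈0 = begin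
    sum f                               ≈⟨ sum-remove {i = k} f ⟩
    f k + sum (removeAt f k)            ≈⟨ ∙-congˡ (sum-single (removeAt f k) vanishes) ⟩
    f k + f (punchIn k (punchOut k≢l))  ≡⟨ ≡.cong (λ j → f k + f j) (punchIn-punchOut k≢l) ⟩
    f k + f l                           ∎
    where
    vanishes : ∀ j → punchOut k≢l ≢ j → f (punchIn k j) ≈ 0#
    vanishes j k′≢j = f≈0 (punchIn k j) (punchInᵢ≢i k j ∘ ≡.sym)
      (λ l≡ → k′≢j (punchIn-injective k _ _ (≡.trans (punchIn-punchOut k≢l) l≡)))

-- The reflective solver only handles rings without free variables, and with the ring's own
-- elements as coefficients the normaliser cannot recognise a vanishing coefficient; integer
-- coefficients avoid both problems.
module IntegerCoefficientSolver {c ℓ} (R : CommutativeRing c ℓ) where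
  open CommutativeRing R hiding (zero)
  open import Algebra.Properties.Ring ring
    using (-‿distribˡ-*; -‿distribʳ-*; -‿involutive; -0#≈0#; -‿+-comm)
  open import Algebra.Properties.Semiring.Mult semiring using (×-homo-+; ×1-homo-*)
    renaming (_×_ to _×ᵣ_)
  open import Algebra.Properties.CommutativeSemigroup +-commutativeSemigroup using (interchange)
  open import Algebra.Solver.Ring.AlmostCommutativeRing
    using (fromCommutativeRing; _-Raw-AlmostCommutative⟶_)
  open import Data.Integer as ℤ using (ℤ; +_; -[1+_]; _⊖_)
  import Data.Integer.Properties as ℤ
  open import Relation.Binary.Reasoning.Setoid setoid

  ι : ℤ → Carrier
  ι (+ n)    = n ×ᵣ 1#
  ι -[1+ n ] = - (suc n ×ᵣ 1#)

  ι-neg : ∀ i → ι (ℤ.- i) ≈ - ι i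
  ι-neg (+ zero)  = sym -0#≈0#
  ι-neg (+ suc n) = refl
  ι-neg -[1+ n ]  = sym (-‿involutive _)

  ι-⊖ : ∀ m n → ι (m ⊖ n) ≈ m ×ᵣ 1# - n ×ᵣ 1#
  ι-⊖ zero n = begin
    ι (zero ⊖ n)  ≡⟨ ≡.cong ι (ℤ.⊖-≤ (ℕ.z≤n {n})) ⟩
    ι (ℤ.- + n)   ≈⟨ ι-neg (+ n) ⟩
    - (n ×ᵣ 1#)   ≈⟨ +-identityˡ _ ⟨
    0# - n ×ᵣ 1#  ∎
  ι-⊖ (suc m) zero = sym (trans (+-congˡ -0#≈0#) (+-identityʳ _))
  ι-⊖ (suc m) (suc n) = begin
    ι (suc m ⊖ suc n)                  ≡⟨ ≡.cong ι (ℤ.[1+m]⊖[1+n]≡m⊖n m n) ⟩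
    ι (m ⊖ n)                          ≈⟨ ι-⊖ m n ⟩
    m ×ᵣ 1# - n ×ᵣ 1#                  ≈⟨ +-identityˡ _ ⟨
    0# + (m ×ᵣ 1# - n ×ᵣ 1#)           ≈⟨ +-congʳ (-‿inverseʳ 1#) ⟨
    (1# - 1#) + (m ×ᵣ 1# - n ×ᵣ 1#)    ≈⟨ interchange 1# (- 1#) (m ×ᵣ 1#) (- (n ×ᵣ 1#)) ⟩
    (1# + m ×ᵣ 1#) + (- 1# - n ×ᵣ 1#)  ≈⟨ +-congˡ (-‿+-comm 1# (n ×ᵣ 1#)) ⟩
    (1# + m ×ᵣ 1#) - (1# + n ×ᵣ 1#)    ∎

  ι-+ : ∀ i j → ι (i ℤ.+ j) ≈ ι i + ι j
  ι-+ (+ m)    (+ n)    = ×-homo-+ 1# m n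
  ι-+ (+ m)    -[1+ n ] = ι-⊖ m (suc n)
  ι-+ -[1+ m ] (+ n)    = trans (ι-⊖ n (suc m)) (+-comm _ _)
  ι-+ -[1+ m ] -[1+ n ] = begin
    - (suc (suc (m ℕ.+ n)) ×ᵣ 1#)      ≡⟨ ≡.cong (λ k → - (k ×ᵣ 1#)) (ℕ.+-suc (suc m) n) ⟨
    - ((suc m ℕ.+ suc n) ×ᵣ 1#)        ≈⟨ -‿cong (×-homo-+ 1# (suc m) (suc n)) ⟩
    - (suc m ×ᵣ 1# + suc n ×ᵣ 1#)      ≈⟨ -‿+-comm _ _ ⟨
    - (suc m ×ᵣ 1#) + - (suc n ×ᵣ 1#)  ∎

  ι-* : ∀ i j → ι (i ℤ.* j) ≈ ι i * ι j
  ι-* (+ m)    (+ n)    = trans (reflexive (≡.cong ι (ℤ.+◃n≡+n (m ℕ.* n)))) (×1-homo-* m n)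
  ι-* (+ m)    -[1+ n ] = begin
    ι (Sign.- ℤ.◃ (m ℕ.* suc n))  ≡⟨ ≡.cong ι (ℤ.-◃n≡-n (m ℕ.* suc n)) ⟩
    ι (ℤ.- + (m ℕ.* suc n))       ≈⟨ ι-neg (+ (m ℕ.* suc n)) ⟩
    - ((m ℕ.* suc n) ×ᵣ 1#)       ≈⟨ -‿cong (×1-homo-* m (suc n)) ⟩
    - (m ×ᵣ 1# * suc n ×ᵣ 1#)     ≈⟨ -‿distribʳ-* _ _ ⟩
    m ×ᵣ 1# * - (suc n ×ᵣ 1#)     ∎
  ι-* -[1+ m ] (+ n)    = begin
    ι (Sign.- ℤ.◃ (suc m ℕ.* n))  ≡⟨ ≡.cong ι (ℤ.-◃n≡-n (suc m ℕ.* n)) ⟩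
    ι (ℤ.- + (suc m ℕ.* n))       ≈⟨ ι-neg (+ (suc m ℕ.* n)) ⟩
    - ((suc m ℕ.* n) ×ᵣ 1#)       ≈⟨ -‿cong (×1-homo-* (suc m) n) ⟩
    - (suc m ×ᵣ 1# * n ×ᵣ 1#)     ≈⟨ -‿distribˡ-* _ _ ⟩
    - (suc m ×ᵣ 1#) * n ×ᵣ 1#     ∎
  ι-* -[1+ m ] -[1+ n ] = begin
    (suc m ℕ.* suc n) ×ᵣ 1#            ≈⟨ ×1-homo-* (suc m) (suc n) ⟩
    suc m ×ᵣ 1# * suc n ×ᵣ 1#          ≈⟨ -‿involutive _ ⟨
    - - (suc m ×ᵣ 1# * suc n ×ᵣ 1#)    ≈⟨ -‿cong (-‿distribˡ-* _ _) ⟩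
    - (- (suc m ×ᵣ 1#) * suc n ×ᵣ 1#)  ≈⟨ -‿distribʳ-* _ _ ⟩
    - (suc m ×ᵣ 1#) * - (suc n ×ᵣ 1#)  ∎

  homomorphism : ℤ.+-*-rawRing -Raw-AlmostCommutative⟶ fromCommutativeRing R
  homomorphism = record
    { ⟦_⟧    = ι
    ; +-homo = ι-+
    ; *-homo = ι-*
    ; -‿homo = ι-neg
    ; 0-homo = refl
    ; 1-homo = +-identityʳ 1#
    }

  open import Algebra.Solver.Ring ℤ.+-*-rawRing (fromCommutativeRing R) homomorphism
    (λ i j → Data.Maybe.map (λ i≡j → reflexive (≡.cong ι i≡j)) (dec⇒weaklyDec ℤ._≟_ i j))
    public

module CommutativeRingProperties {c ℓ} (R : CommutativeRing c ℓ) where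
  open CommutativeRing R
  open IntegerCoefficientSolver R using (solve; _:*_; _:=_)
  open import Relation.Binary.Reasoning.Setoid setoid

  det₂ : Carrier → Carrier → Carrier → Carrier → Carrier
  det₂ a b c d = a * d - b * c

  cross-multiplication⇒proportional : ∀ {a a⁻¹ b x y} → a * a⁻¹ ≈ 1# → a * y ≈ x * b →
                                      y ≈ (b * a⁻¹) * x
  cross-multiplication⇒proportional {a} {a⁻¹} {b} {x} {y} inverse cross = begin
    y              ≈⟨ *-identityˡ y ⟨
    1# * y         ≈⟨ *-congʳ inverse ⟨
    (a * a⁻¹) * y  ≈⟨ solve 3 (λ a a⁻¹ y → (a :* a⁻¹) :* y := a⁻¹ :* (a :* y)) refl a a⁻¹ y ⟩
    a⁻¹ * (a * y)  ≈⟨ *-congˡ cross ⟩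
    a⁻¹ * (x * b)  ≈⟨ solve 3 (λ a⁻¹ x b → a⁻¹ :* (x :* b) := (b :* a⁻¹) :* x) refl a⁻¹ x b ⟩
    (b * a⁻¹) * x  ∎

  difference-of-multiples : ∀ {u v} s t → u ≈ 0# → v ≈ 0# → s * u - t * v ≈ 0#
  difference-of-multiples s t u≈0 v≈0 = begin
    s * _ - t * _    ≈⟨ +-cong (*-congˡ u≈0) (-‿cong (*-congˡ v≈0)) ⟩
    s * 0# - t * 0#  ≈⟨ +-cong (zeroʳ s) (-‿cong (zeroʳ t)) ⟩
    0# - 0#          ≈⟨ -‿inverseʳ 0# ⟩
    0#               ∎

ZeroProduct : ∀ {c ℓ} → CommutativeRing c ℓ → Set (c ⊔ ℓ)
ZeroProduct R = ∀ {x y} → x * y ≈ 0# → x ≈ 0# ⊎ y ≈ 0#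
  where open CommutativeRing R

module IntegralDomain {c ℓ} (R : CommutativeRing c ℓ) (zero-product : ZeroProduct R) where
  open CommutativeRing R
  open CommutativeRingProperties R public
  open IntegerCoefficientSolver R using (solve; _:+_; _:*_; _:-_; _:=_)
  open import Algebra.Properties.Ring ring using (x∙y⁻¹≈ε⇒x≈y; x≈y⇒x∙y⁻¹≈ε; x[y-z]≈xy-xz)
  open import Relation.Binary.Reasoning.Setoid setoid

  x≉0∧xy≈0⇒y≈0 : ∀ {x y} → x ≉ 0# → x * y ≈ 0# → y ≈ 0#
  x≉0∧xy≈0⇒y≈0 x≉0 xy≈0 with zero-product xy≈0
  ... | inj₁ x≈0 = contradiction x≈0 x≉0
  ... | inj₂ y≈0 = y≈0

  ≉⇒-≉0 : ∀ {x y} → x ≉ y → x - y ≉ 0#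
  ≉⇒-≉0 {x} {y} x≉y = x≉y ∘ x∙y⁻¹≈ε⇒x≈y x y

  *-cancelˡ-≉0 : ∀ {x y z} → x ≉ 0# → x * y ≈ x * z → y ≈ z
  *-cancelˡ-≉0 {x} {y} {z} x≉0 xy≈xz = x∙y⁻¹≈ε⇒x≈y y z (x≉0∧xy≈0⇒y≈0 x≉0 (begin
    x * (y - z)    ≈⟨ x[y-z]≈xy-xz x y z ⟩
    x * y - x * z  ≈⟨ x≈y⇒x∙y⁻¹≈ε xy≈xz ⟩
    0#             ∎))

  cramer : ∀ {a b c d x y} → det₂ a b c d ≉ 0# →
           a * x + b * y ≈ 0# → c * x + d * y ≈ 0# → x ≈ 0# × y ≈ 0#
  cramer {a} {b} {c} {d} {x} {y} det≉0 row₁ row₂ =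
      x≉0∧xy≈0⇒y≈0 det≉0 (trans (eliminate-y a b c d x y) (difference-of-multiples d b row₁ row₂))
    , x≉0∧xy≈0⇒y≈0 det≉0 (trans (eliminate-x a b c d x y) (difference-of-multiples a c row₂ row₁))
    where
    eliminate-y : ∀ a b c d x y → det₂ a b c d * x ≈ d * (a * x + b * y) - b * (c * x + d * y)
    eliminate-y = solve 6 (λ a b c d x y →
      (a :* d :- b :* c) :* x := d :* (a :* x :+ b :* y) :- b :* (c :* x :+ d :* y)) refl
    eliminate-x : ∀ a b c d x y → det₂ a b c d * y ≈ a * (c * x + d * y) - c * (a * x + b * y)
    eliminate-x = solve 6 (λ a b c d x y →
      (a :* d :- b :* c) :* y := a :* (c :* x :+ d :* y) :- c :* (a :* x :+ b :* y)) refl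

  quadratic-root-bound : ∀ {a b c x y z} → x ≉ y → x ≉ z → y ≉ z →
    a * (x * x) + b * x + c ≈ 0# → a * (y * y) + b * y + c ≈ 0# → a * (z * z) + b * z + c ≈ 0# →
    a ≈ 0#
  quadratic-root-bound {a} {b} {c} {x} {y} {z} x≉y x≉z y≉z fx≈0 fy≈0 fz≈0 =
    x≉0∧xy≈0⇒y≈0 (≉⇒-≉0 y≉z) (begin
      (y - z) * a  ≈⟨ solve 5 (λ a b x y z → (y :- z) :* a := (a :* (x :+ y) :+ b) :- (a :* (x :+ z) :+ b))
                        refl a b x y z ⟩
      g y - g z    ≈⟨ x≈y⇒x∙y⁻¹≈ε (trans (g-vanishes x≉y fy≈0) (sym (g-vanishes x≉z fz≈0))) ⟩
      0#           ∎)
    where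
    f g : Carrier → Carrier
    f t = a * (t * t) + b * t + c
    g t = a * (x + t) + b
    g-vanishes : ∀ {t} → x ≉ t → f t ≈ 0# → g t ≈ 0#
    g-vanishes {t} x≉t ft≈0 = x≉0∧xy≈0⇒y≈0 (≉⇒-≉0 x≉t) (begin
      (x - t) * g t  ≈⟨ solve 5 (λ a b c x t → (x :- t) :* (a :* (x :+ t) :+ b) :=
                                  (a :* (x :* x) :+ b :* x :+ c) :- (a :* (t :* t) :+ b :* t :+ c))
                          refl a b c x t ⟩
      f x - f t      ≈⟨ x≈y⇒x∙y⁻¹≈ε (trans fx≈0 (sym ft≈0)) ⟩
      0#             ∎)

  pencil-minor-root-bound : ∀ {a b c d x y z w μ₁ μ₂ μ₃} → det₂ a b c d ≉ 0# →
    μ₁ ≉ μ₂ → μ₁ ≉ μ₃ → μ₂ ≉ μ₃ →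
    det₂ (x - μ₁ * a) (y - μ₁ * b) (z - μ₁ * c) (w - μ₁ * d) ≈ 0# →
    det₂ (x - μ₂ * a) (y - μ₂ * b) (z - μ₂ * c) (w - μ₂ * d) ≈ 0# →
    det₂ (x - μ₃ * a) (y - μ₃ * b) (z - μ₃ * c) (w - μ₃ * d) ≉ 0#
  pencil-minor-root-bound {a} {b} {c} {d} {x} {y} {z} {w} det≉0 μ₁≉μ₂ μ₁≉μ₃ μ₂≉μ₃
                          root₁ root₂ root₃ =
    det≉0 (quadratic-root-bound μ₁≉μ₂ μ₁≉μ₃ μ₂≉μ₃
             (as-quadratic root₁) (as-quadratic root₂) (as-quadratic root₃))
    where
    expand : ∀ μ → det₂ (x - μ * a) (y - μ * b) (z - μ * c) (w - μ * d) ≈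
             det₂ a b c d * (μ * μ) + (y * c + b * z - x * d - a * w) * μ + det₂ x y z w
    expand = solve 9 (λ a b c d x y z w μ →
      (x :- μ :* a) :* (w :- μ :* d) :- (y :- μ :* b) :* (z :- μ :* c) :=
      (a :* d :- b :* c) :* (μ :* μ) :+ (y :* c :+ b :* z :- x :* d :- a :* w) :* μ :+ (x :* w :- y :* z))
      refl a b c d x y z w
    as-quadratic : ∀ {μ} → det₂ (x - μ * a) (y - μ * b) (z - μ * c) (w - μ * d) ≈ 0# →
                   det₂ a b c d * (μ * μ) + (y * c + b * z - x * d - a * w) * μ + det₂ x y z w ≈ 0#
    as-quadratic {μ} root = trans (sym (expand μ)) root

injective⇒surjective : ∀ {n} {f : Fin n → Fin n} → Injective _≡_ _≡_ f → ∀ y → ∃ λ x → f x ≡ y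
injective⇒surjective {suc n} {f} f-injective y with any? (λ x → f x ≟ y)
... | yes hit  = hit
... | no  miss = contradiction (injective⇒≤ f-avoiding-y-injective) (ℕ.n≮n n)
  where
  f-avoiding-y : Fin (suc n) → Fin n
  f-avoiding-y x = punchOut (miss ∘ (x ,_) ∘ ≡.sym)
  f-avoiding-y-injective : Injective _≡_ _≡_ f-avoiding-y
  f-avoiding-y-injective {x} {x′} eq =
    f-injective (punchOut-injective (miss ∘ (x ,_) ∘ ≡.sym) (miss ∘ (x′ ,_) ∘ ≡.sym) eq)

module _ {a} {A : Set a} where

  Unique⇒lookup-injective : ∀ {xs : List A} → Unique xs → Injective _≡_ _≡_ (List.lookup xs)
  Unique⇒lookup-injective (_  ∷ _)         {zero}  {zero}  _  = ≡.refl
  Unique⇒lookup-injective (x∉ ∷ _)         {zero}  {suc j} eq = contradiction eq (All.lookup x∉ (∈-lookup j))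
  Unique⇒lookup-injective (x∉ ∷ _)         {suc i} {zero}  eq =
    contradiction (≡.sym eq) (All.lookup x∉ (∈-lookup i))
  Unique⇒lookup-injective (_  ∷ xs-unique) {suc i} {suc j} eq =
    ≡.cong suc (Unique⇒lookup-injective xs-unique eq)

  length≤-by-encoding : ∀ {p} {P : A → Set p} {N} {xs : List A} →
    Unique xs → (∀ {x} → x ∈ xs → P x) →
    (code : ∀ x → P x → Fin N) → (∀ {x y} (px : P x) (py : P y) → code x px ≡ code y py → x ≡ y) →
    length xs ≤ N
  length≤-by-encoding {xs = xs} xs-unique P-xs code code-injective =
    injective⇒≤ {f = λ i → code (List.lookup xs i) (P-xs (∈-lookup i))}
      (λ eq → Unique⇒lookup-injective xs-unique (code-injective _ _ eq))

lookup-≗⇒≡ : ∀ {a} {A : Set a} {n} {xs ys : Vec A n} → lookup xs ≗ lookup ys → xs ≡ ys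
lookup-≗⇒≡ {xs = xs} {ys} eq =
  ≡.trans (≡.sym (Vec.tabulate∘lookup xs)) (≡.trans (Vec.tabulate-cong eq) (Vec.tabulate∘lookup ys))

funToFin-injective : ∀ {m n} {f g : Fin m → Fin n} → Fin.funToFin f ≡ Fin.funToFin g → f ≗ g
funToFin-injective {f = f} {g} eq x = ≡.trans (≡.sym (Fin.finToFun-funToFin f x))
  (≡.trans (≡.cong (λ c → Fin.finToFun c x) eq) (Fin.finToFun-funToFin g x))

length≤-of-vectors : ∀ {m d} {W : List (Vec (Fin m) d)} → Unique W → length W ≤ m ^ d
length≤-of-vectors W-unique =
  length≤-by-encoding {P = λ _ → ⊤} W-unique _ (λ w _ → Fin.funToFin (lookup w))
    (λ _ _ same-code → lookup-≗⇒≡ (funToFin-injective same-code))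

module _ {a} {A : Set a} {n : ℕ} where

  removeAt-punchOut : (u : Vector A (suc n)) {k j : Fin (suc n)} (k≢j : k ≢ j) →
                      removeAt u k (punchOut k≢j) ≡ u j
  removeAt-punchOut u k≢j = ≡.cong u (punchIn-punchOut k≢j)

  removeAt-≗⇒agree : ∀ {u u′ : Vector A (suc n)} {k} → removeAt u k ≗ removeAt u′ k →
                     ∀ {j} → k ≢ j → u j ≡ u′ j
  removeAt-≗⇒agree {u} {u′} eq k≢j =
    ≡.trans (≡.sym (removeAt-punchOut u k≢j)) (≡.trans (eq _) (removeAt-punchOut u′ k≢j))

  agree⇒≗ : ∀ {u u′ : Vector A n} {k} → u k ≡ u′ k → (∀ {j} → k ≢ j → u j ≡ u′ j) → u ≗ u′
  agree⇒≗ {k = k} uk≡u′k agree j with k ≟ j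
  ... | yes ≡.refl = uk≡u′k
  ... | no  k≢j    = agree k≢j

removeAt₂-≗⇒agree : ∀ {a} {A : Set a} {n} {u u′ : Vector A (suc (suc n))} {k l} (k≢l : k ≢ l) →
  removeAt (removeAt u k) (punchOut k≢l) ≗ removeAt (removeAt u′ k) (punchOut k≢l) →
  ∀ {j} → k ≢ j → l ≢ j → u j ≡ u′ j
removeAt₂-≗⇒agree {u = u} {u′} {k} k≢l eq k≢j l≢j = ≡.trans (≡.sym (removeAt-punchOut u k≢j))
  (≡.trans (removeAt-≗⇒agree {u = removeAt u k} {removeAt u′ k} eq (l≢j ∘ punchOut-injective k≢l k≢j))
           (removeAt-punchOut u′ k≢j))

module IntegersModulo (p : ℕ) .{{_ : NonZero p}} where
  open Field p
  open ≡ using (refl; sym; trans; cong)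
  open ≡.≡-Reasoning
  open import Algebra.Consequences.Propositional using (comm∧idˡ⇒id; comm∧invˡ⇒inv; comm∧distrʳ⇒distr)
  open import Relation.Binary.PropositionalEquality.Algebra using (isMagma)

  [_] : ℕ → 𝔽 p
  [ m ] = m mod p

  toℕ-[] : ∀ m → toℕ [ m ] ≡ m % p
  toℕ-[] m = toℕ-fromℕ< _

  toℕ-0F : toℕ 0F ≡ 0
  toℕ-0F = trans (toℕ-[] 0) (m<n⇒m%n≡m (ℕ.>-nonZero⁻¹ p))

  []-toℕ : ∀ a → [ toℕ a ] ≡ a
  []-toℕ a = toℕ-injective (trans (toℕ-[] (toℕ a)) (m<n⇒m%n≡m (toℕ<n a)))

  []-+ : ∀ m n → [ m ℕ.+ n ] ≡ [ m ] +F [ n ]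
  []-+ m n = toℕ-injective (begin
    toℕ [ m ℕ.+ n ]                ≡⟨ toℕ-[] _ ⟩
    (m ℕ.+ n) % p                  ≡⟨ %-distribˡ-+ m n p ⟩
    (m % p ℕ.+ n % p) % p          ≡⟨ ≡.cong₂ (λ x y → (x ℕ.+ y) % p) (toℕ-[] m) (toℕ-[] n) ⟨
    (toℕ [ m ] ℕ.+ toℕ [ n ]) % p  ≡⟨ toℕ-[] _ ⟨
    toℕ ([ m ] +F [ n ])           ∎)

  []-* : ∀ m n → [ m ℕ.* n ] ≡ [ m ] *F [ n ]
  []-* m n = toℕ-injective (begin
    toℕ [ m ℕ.* n ]                ≡⟨ toℕ-[] _ ⟩
    (m ℕ.* n) % p                  ≡⟨ %-distribˡ-* m n p ⟩
    (m % p ℕ.* (n % p)) % p        ≡⟨ ≡.cong₂ (λ x y → (x ℕ.* y) % p) (toℕ-[] m) (toℕ-[] n) ⟨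
    (toℕ [ m ] ℕ.* toℕ [ n ]) % p  ≡⟨ toℕ-[] _ ⟨
    toℕ ([ m ] *F [ n ])           ∎)

  [p]≡0F : [ p ] ≡ 0F
  [p]≡0F = toℕ-injective (trans (toℕ-[] p) (trans (n%n≡0 p) (sym toℕ-0F)))

  -F_ : 𝔽 p → 𝔽 p
  -F a = [ p ℕ.∸ toℕ a ]

  1F : 𝔽 p
  1F = [ 1 ]

  +F-comm : ∀ a b → a +F b ≡ b +F a
  +F-comm a b = cong [_] (ℕ.+-comm (toℕ a) (toℕ b))

  *F-comm : ∀ a b → a *F b ≡ b *F a
  *F-comm a b = cong [_] (ℕ.*-comm (toℕ a) (toℕ b))

  +F-assoc : ∀ a b c → (a +F b) +F c ≡ a +F (b +F c)
  +F-assoc a b c = begin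
    (a +F b) +F c            ≡⟨ cong ((a +F b) +F_) ([]-toℕ c) ⟨
    [ ta ℕ.+ tb ] +F [ tc ]  ≡⟨ []-+ (ta ℕ.+ tb) tc ⟨
    [ ta ℕ.+ tb ℕ.+ tc ]     ≡⟨ cong [_] (ℕ.+-assoc ta tb tc) ⟩
    [ ta ℕ.+ (tb ℕ.+ tc) ]   ≡⟨ []-+ ta (tb ℕ.+ tc) ⟩
    [ ta ] +F [ tb ℕ.+ tc ]  ≡⟨ cong (_+F (b +F c)) ([]-toℕ a) ⟩
    a +F (b +F c)            ∎
    where ta = toℕ a; tb = toℕ b; tc = toℕ c

  *F-assoc : ∀ a b c → (a *F b) *F c ≡ a *F (b *F c)
  *F-assoc a b c = begin
    (a *F b) *F c            ≡⟨ cong ((a *F b) *F_) ([]-toℕ c) ⟨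
    [ ta ℕ.* tb ] *F [ tc ]  ≡⟨ []-* (ta ℕ.* tb) tc ⟨
    [ ta ℕ.* tb ℕ.* tc ]     ≡⟨ cong [_] (ℕ.*-assoc ta tb tc) ⟩
    [ ta ℕ.* (tb ℕ.* tc) ]   ≡⟨ []-* ta (tb ℕ.* tc) ⟩
    [ ta ] *F [ tb ℕ.* tc ]  ≡⟨ cong (_*F (b *F c)) ([]-toℕ a) ⟩
    a *F (b *F c)            ∎
    where ta = toℕ a; tb = toℕ b; tc = toℕ c

  +F-identityˡ : ∀ a → 0F +F a ≡ a
  +F-identityˡ a = begin
    0F +F a             ≡⟨ cong (0F +F_) ([]-toℕ a) ⟨
    [ 0 ] +F [ toℕ a ]  ≡⟨ []-+ 0 (toℕ a) ⟨
    [ toℕ a ]           ≡⟨ []-toℕ a ⟩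
    a                   ∎

  *F-identityˡ : ∀ a → 1F *F a ≡ a
  *F-identityˡ a = begin
    1F *F a             ≡⟨ cong (1F *F_) ([]-toℕ a) ⟨
    [ 1 ] *F [ toℕ a ]  ≡⟨ []-* 1 (toℕ a) ⟨
    [ 1 ℕ.* toℕ a ]     ≡⟨ cong [_] (ℕ.*-identityˡ (toℕ a)) ⟩
    [ toℕ a ]           ≡⟨ []-toℕ a ⟩
    a                   ∎

  -F-inverseˡ : ∀ a → (-F a) +F a ≡ 0F
  -F-inverseˡ a = begin
    (-F a) +F a                   ≡⟨ cong ((-F a) +F_) ([]-toℕ a) ⟨
    [ p ℕ.∸ toℕ a ] +F [ toℕ a ]  ≡⟨ []-+ (p ℕ.∸ toℕ a) (toℕ a) ⟨
    [ p ℕ.∸ toℕ a ℕ.+ toℕ a ]     ≡⟨ cong [_] (ℕ.m∸n+n≡m (ℕ.<⇒≤ (toℕ<n a))) ⟩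
    [ p ]                         ≡⟨ [p]≡0F ⟩
    0F                            ∎

  *F-distribʳ-+F : ∀ a b c → (b +F c) *F a ≡ (b *F a) +F (c *F a)
  *F-distribʳ-+F a b c = begin
    (b +F c) *F a                ≡⟨ cong ((b +F c) *F_) ([]-toℕ a) ⟨
    [ tb ℕ.+ tc ] *F [ ta ]      ≡⟨ []-* (tb ℕ.+ tc) ta ⟨
    [ (tb ℕ.+ tc) ℕ.* ta ]       ≡⟨ cong [_] (ℕ.*-distribʳ-+ ta tb tc) ⟩
    [ tb ℕ.* ta ℕ.+ tc ℕ.* ta ]  ≡⟨ []-+ (tb ℕ.* ta) (tc ℕ.* ta) ⟩
    (b *F a) +F (c *F a)         ∎
    where ta = toℕ a; tb = toℕ b; tc = toℕ c

  +F-*F-isCommutativeRing : IsCommutativeRing _≡_ _+F_ _*F_ -F_ 0F 1F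
  +F-*F-isCommutativeRing = record
    { isRing = record
      { +-isAbelianGroup = record
        { isGroup = record
          { isMonoid = record
            { isSemigroup = record { isMagma = isMagma _+F_ ; assoc = +F-assoc }
            ; identity    = comm∧idˡ⇒id +F-comm +F-identityˡ
            }
          ; inverse = comm∧invˡ⇒inv +F-comm -F-inverseˡ
          ; ⁻¹-cong = cong -F_
          }
        ; comm = +F-comm
        }
      ; *-cong     = ≡.cong₂ _*F_
      ; *-assoc    = *F-assoc
      ; *-identity = comm∧idˡ⇒id *F-comm *F-identityˡ
      ; distrib    = comm∧distrʳ⇒distr (≡.cong₂ _+F_) *F-comm *F-distribʳ-+F
      }
    ; *-comm = *F-comm
    }

  commutativeRing : CommutativeRing _ _
  commutativeRing = record { isCommutativeRing = +F-*F-isCommutativeRing }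

module PrimeField (p : ℕ) .{{_ : NonZero p}} (prime : Prime p) where
  open Field p
  open IntegersModulo p public
  open ≡ using (cong)
  open ≡.≡-Reasoning

  p∣⇒≡0F : ∀ {a} → p ∣ toℕ a → a ≡ 0F
  p∣⇒≡0F {a} p∣a = toℕ-injective (begin
    toℕ a      ≡⟨ m<n⇒m%n≡m (toℕ<n a) ⟨
    toℕ a % p  ≡⟨ n∣m⇒m%n≡0 (toℕ a) p p∣a ⟩
    0          ≡⟨ toℕ-0F ⟨
    toℕ 0F     ∎)

  *F-zero-product : ∀ {a b} → a *F b ≡ 0F → a ≡ 0F ⊎ b ≡ 0F
  *F-zero-product {a} {b} ab≡0 =
    Data.Sum.map p∣⇒≡0F p∣⇒≡0F (euclidsLemma (toℕ a) (toℕ b) prime (m%n≡0⇒n∣m _ p (begin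
      (toℕ a ℕ.* toℕ b) % p  ≡⟨ toℕ-[] _ ⟨
      toℕ (a *F b)           ≡⟨ cong toℕ ab≡0 ⟩
      toℕ 0F                 ≡⟨ toℕ-0F ⟩
      0                      ∎)))

  1F≢0F : 1F ≢ 0F
  1F≢0F 1≡0 = ℕ.1+n≢0 (begin
    1          ≡⟨ m<n⇒m%n≡m (ℕ.nonTrivial⇒n>1 p {{prime⇒nonTrivial prime}}) ⟨
    1 % p      ≡⟨ toℕ-[] 1 ⟨
    toℕ 1F     ≡⟨ cong toℕ 1≡0 ⟩
    toℕ 0F     ≡⟨ toℕ-0F ⟩
    0          ∎)

  open IntegralDomain commutativeRing *F-zero-product public

  *F-inverse : ∀ {a} → a ≢ 0F → ∃ λ b → a *F b ≡ 1F
  *F-inverse a≢0 = injective⇒surjective (*-cancelˡ-≉0 a≢0) 1F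

module LinearAlgebra (p : ℕ) .{{_ : NonZero p}} (prime : Prime p) where
  open Field p
  open PrimeField p prime
  open CommutativeRing commutativeRing
    using ( _+_; _*_; -_; _-_; +-commutativeMonoid; semiring; +-identityˡ; +-identityʳ; zeroˡ; zeroʳ
          ; *-comm; *-assoc; *-identityˡ; distribʳ; -‿inverseʳ )
  open import Algebra.Properties.Ring (CommutativeRing.ring commutativeRing)
    using (-1*x≈-x; x∙y⁻¹≈ε⇒x≈y; x≈y⇒x∙y⁻¹≈ε; -‿distribˡ-*; -‿injective; -0#≈0#)
  open IntegerCoefficientSolver commutativeRing using (solve; _:+_; _:*_; _:-_; :-_; _:=_)
  open import Algebra.Properties.Semiring.Sum semiring
    using (sum; sum-cong-≗; ∑-distrib-+; ∑-comm; *-distribˡ-sum; *-distribʳ-sum)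
  open CommutativeMonoidSum +-commutativeMonoid using (sum-single; sum-pair)
  open ≡ using (refl; sym; trans; cong; cong₂)
  open ≡.≡-Reasoning

  Σ≡sum : ∀ {d} (f : Fin d → 𝔽 p) → Σ[ d ] f ≡ sum f
  Σ≡sum {zero}  f = refl
  Σ≡sum {suc d} f = cong (f zero +_) (Σ≡sum (f ∘ suc))

  ·≡sum : ∀ {d} (x y : Vect d) → x · y ≡ sum (λ i → x i * y i)
  ·≡sum x y = Σ≡sum (λ i → x i * y i)

  _·ᵣ_ : ∀ {d} → Mat d → Vect d → Vect d
  (M ·ᵣ u) i = M i · u

  unit : ∀ {d} → Fin d → Vect d
  unit k j with k ≟ j
  ... | yes _ = 1F
  ... | no  _ = 0F

  module _ {d : ℕ} where

    ·-comm : (x y : Vect d) → x · y ≡ y · x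
    ·-comm x y = begin
      x · y                  ≡⟨ ·≡sum x y ⟩
      sum (λ i → x i * y i)  ≡⟨ sum-cong-≗ (λ i → *-comm (x i) (y i)) ⟩
      sum (λ i → y i * x i)  ≡⟨ ·≡sum y x ⟨
      y · x                  ∎

    ·-congˡ : ∀ {x x′ : Vect d} → x ≗ x′ → (u : Vect d) → x · u ≡ x′ · u
    ·-congˡ {x} {x′} x≗x′ u = begin
      x · u                   ≡⟨ ·≡sum x u ⟩
      sum (λ i → x i * u i)   ≡⟨ sum-cong-≗ (λ i → cong (_* u i) (x≗x′ i)) ⟩
      sum (λ i → x′ i * u i)  ≡⟨ ·≡sum x′ u ⟨
      x′ · u                  ∎

    ·-distribʳ-⊕ : (x y u : Vect d) → (x ⊕ y) · u ≡ x · u + y · u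
    ·-distribʳ-⊕ x y u = begin
      (x ⊕ y) · u                                    ≡⟨ ·≡sum (x ⊕ y) u ⟩
      sum (λ i → (x i + y i) * u i)                  ≡⟨ sum-cong-≗ (λ i → distribʳ (u i) (x i) (y i)) ⟩
      sum (λ i → x i * u i + y i * u i)              ≡⟨ ∑-distrib-+ (λ i → x i * u i) (λ i → y i * u i) ⟩
      sum (λ i → x i * u i) + sum (λ i → y i * u i)  ≡⟨ cong₂ _+_ (·≡sum x u) (·≡sum y u) ⟨
      x · u + y · u                                  ∎

    ·-scaleˡ : (c : 𝔽 p) (x u : Vect d) → (λ i → c * x i) · u ≡ c * (x · u)
    ·-scaleˡ c x u = begin
      (λ i → c * x i) · u          ≡⟨ ·≡sum (λ i → c * x i) u ⟩
      sum (λ i → c * x i * u i)    ≡⟨ sum-cong-≗ (λ i → *-assoc c (x i) (u i)) ⟩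
      sum (λ i → c * (x i * u i))  ≡⟨ *-distribˡ-sum c (λ i → x i * u i) ⟨
      c * sum (λ i → x i * u i)    ≡⟨ cong (c *_) (·≡sum x u) ⟨
      c * (x · u)                  ∎

    ·-zeroˡ : (u : Vect d) → (λ _ → 0F) · u ≡ 0F
    ·-zeroˡ u = begin
      (λ _ → 0F) · u        ≡⟨ ·≡sum (λ _ → 0F) u ⟩
      sum (λ i → 0F * u i)  ≡⟨ *-distribˡ-sum 0F u ⟨
      0F * sum u            ≡⟨ zeroˡ _ ⟩
      0F                    ∎

    ·-distribʳ-⊖ : (x y u : Vect d) → (λ i → x i - y i) · u ≡ x · u - y · u
    ·-distribʳ-⊖ x y u = begin
      (λ i → x i - y i) · u           ≡⟨ ·-distribʳ-⊕ x (λ i → - y i) u ⟩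
      x · u + (λ i → - y i) · u       ≡⟨ cong (x · u +_) (·-congˡ (λ i → -1*x≈-x (y i)) u) ⟨
      x · u + (λ i → - 1F * y i) · u  ≡⟨ cong (x · u +_) (·-scaleˡ (- 1F) y u) ⟩
      x · u + - 1F * (y · u)          ≡⟨ cong (x · u +_) (-1*x≈-x (y · u)) ⟩
      x · u - y · u                   ∎

    ⊛-·-assoc : (n : Vect d) (M : Mat d) (u : Vect d) → (n ⊛ M) · u ≡ n · (M ·ᵣ u)
    ⊛-·-assoc n M u = begin
      (n ⊛ M) · u
        ≡⟨ ·≡sum (n ⊛ M) u ⟩
      sum (λ j → (n ⊛ M) j * u j)
        ≡⟨ sum-cong-≗ (λ j → cong (_* u j) (Σ≡sum (λ i → n i * M i j))) ⟩
      sum (λ j → sum (λ i → n i * M i j) * u j)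
        ≡⟨ sum-cong-≗ (λ j → *-distribʳ-sum (u j) (λ i → n i * M i j)) ⟩
      sum (λ j → sum (λ i → n i * M i j * u j))
        ≡⟨ ∑-comm (λ j i → n i * M i j * u j) ⟩
      sum (λ i → sum (λ j → n i * M i j * u j))
        ≡⟨ sum-cong-≗ (λ i → sum-cong-≗ (λ j → *-assoc (n i) (M i j) (u j))) ⟩
      sum (λ i → sum (λ j → n i * (M i j * u j)))
        ≡⟨ sum-cong-≗ (λ i → *-distribˡ-sum (n i) (λ j → M i j * u j)) ⟨
      sum (λ i → n i * sum (λ j → M i j * u j))
        ≡⟨ sum-cong-≗ (λ i → cong (n i *_) (·≡sum (M i) u)) ⟨
      sum (λ i → n i * (M ·ᵣ u) i)
        ≡⟨ ·≡sum n (M ·ᵣ u) ⟨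
      n · (M ·ᵣ u)
        ∎

    ·-supported₁ : ∀ {k} (m x : Vect d) → (∀ {j} → k ≢ j → x j ≡ 0F) → m · x ≡ m k * x k
    ·-supported₁ {k} m x x-off-k = begin
      m · x                  ≡⟨ ·≡sum m x ⟩
      sum (λ j → m j * x j)  ≡⟨ sum-single (λ j → m j * x j) vanishes ⟩
      m k * x k              ∎
      where
      vanishes : ∀ j → k ≢ j → m j * x j ≡ 0F
      vanishes j k≢j = trans (cong (m j *_) (x-off-k k≢j)) (zeroʳ (m j))

    ·-supported₂ : ∀ {k l} → k ≢ l → (m x : Vect d) → (∀ {j} → k ≢ j → l ≢ j → x j ≡ 0F) →
                   m · x ≡ m k * x k + m l * x l
    ·-supported₂ {k} {l} k≢l m x x-off-kl = begin
      m · x                  ≡⟨ ·≡sum m x ⟩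
      sum (λ j → m j * x j)  ≡⟨ sum-pair k≢l (λ j → m j * x j) vanishes ⟩
      m k * x k + m l * x l  ∎
      where
      vanishes : ∀ j → k ≢ j → l ≢ j → m j * x j ≡ 0F
      vanishes j k≢j l≢j = trans (cong (m j *_) (x-off-kl k≢j l≢j)) (zeroʳ (m j))

    unit-· : (k : Fin d) (x : Vect d) → unit k · x ≡ x k
    unit-· k x = begin
      unit k · x      ≡⟨ ·-comm (unit k) x ⟩
      x · unit k      ≡⟨ ·-supported₁ x (unit k) unit-off ⟩
      x k * unit k k  ≡⟨ cong (x k *_) unit-diag ⟩
      x k * 1F        ≡⟨ *-comm (x k) 1F ⟩
      1F * x k        ≡⟨ *-identityˡ (x k) ⟩
      x k             ∎
      where
      unit-diag : unit k k ≡ 1F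
      unit-diag with k ≟ k
      ... | yes _   = refl
      ... | no  k≢k = contradiction refl k≢k
      unit-off : ∀ {j} → k ≢ j → unit k j ≡ 0F
      unit-off {j} k≢j with k ≟ j
      ... | yes k≡j = contradiction k≡j k≢j
      ... | no  _   = refl

    combination-· : (a b : 𝔽 p) (k l : Fin d) (x : Vect d) →
                    (λ t → a * unit k t + b * unit l t) · x ≡ a * x k + b * x l
    combination-· a b k l x = begin
      (λ t → a * unit k t + b * unit l t) · x
        ≡⟨ ·-distribʳ-⊕ (λ t → a * unit k t) (λ t → b * unit l t) x ⟩
      (λ t → a * unit k t) · x + (λ t → b * unit l t) · x
        ≡⟨ cong₂ _+_ (·-scaleˡ a (unit k) x) (·-scaleˡ b (unit l) x) ⟩
      a * (unit k · x) + b * (unit l · x)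
        ≡⟨ cong₂ (λ s t → a * s + b * t) (unit-· k x) (unit-· l x) ⟩
      a * x k + b * x l
        ∎

    annihilator-⊆⇒cross-products : ∀ {α β : Vect d} → (∀ n → n · α ≡ 0F → n · β ≡ 0F) →
                                   ∀ i j → α i * β j ≡ α j * β i
    annihilator-⊆⇒cross-products {α} {β} α⊥⊆β⊥ i j = x∙y⁻¹≈ε⇒x≈y _ _ (begin
      α i * β j - α j * β i      ≡⟨ cong (α i * β j +_) (-‿distribˡ-* (α j) (β i)) ⟩
      α i * β j + (- α j) * β i  ≡⟨ combination-· (α i) (- α j) j i β ⟨
      n · β                      ≡⟨ α⊥⊆β⊥ n n·α≡0 ⟩
      0F                         ∎)
      where
      n : Vect d
      n t = α i * unit j t + (- α j) * unit i t
      n·α≡0 : n · α ≡ 0F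
      n·α≡0 = begin
        n · α                      ≡⟨ combination-· (α i) (- α j) j i α ⟩
        α i * α j + (- α j) * α i  ≡⟨ cong (α i * α j +_) (-‿distribˡ-* (α j) (α i)) ⟨
        α i * α j - α j * α i      ≡⟨ cong (λ t → α i * α j - t) (*-comm (α j) (α i)) ⟩
        α i * α j - α i * α j      ≡⟨ -‿inverseʳ _ ⟩
        0F                         ∎

    annihilator-⊆⇒proportional : (α β : Vect d) → (∀ n → n · α ≡ 0F → n · β ≡ 0F) →
                                 ∃ λ μ → ∀ j → β j ≡ μ * α j
    annihilator-⊆⇒proportional α β α⊥⊆β⊥ with all? (λ i → α i ≟ 0F)
    ... | yes α≡0 = 0F , λ j → begin
      β j         ≡⟨ unit-· j β ⟨
      unit j · β  ≡⟨ α⊥⊆β⊥ (unit j) (trans (unit-· j α) (α≡0 j)) ⟩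
      0F          ≡⟨ zeroˡ (α j) ⟨
      0F * α j    ∎
    ... | no α≢0 with ¬∀⟶∃¬ d _ (λ i → α i ≟ 0F) α≢0
    ...   | i , αi≢0 with *F-inverse αi≢0
    ...     | αi⁻¹ , αi*αi⁻¹≡1 = β i * αi⁻¹ , λ j →
      cross-multiplication⇒proportional {a = α i} αi*αi⁻¹≡1 (annihilator-⊆⇒cross-products α⊥⊆β⊥ i j)

    orthogonal-difference : (m u u′ : Vect d) → m · u ≡ 0F → m · u′ ≡ 0F → m · (λ j → u j - u′ j) ≡ 0F
    orthogonal-difference m u u′ m·u≡0 m·u′≡0 = begin
      m · (λ j → u j - u′ j)  ≡⟨ ·-comm m _ ⟩
      (λ j → u j - u′ j) · m  ≡⟨ ·-distribʳ-⊖ u u′ m ⟩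
      u · m - u′ · m          ≡⟨ cong₂ _-_ (·-comm u m) (·-comm u′ m) ⟩
      m · u - m · u′          ≡⟨ cong₂ _-_ m·u≡0 m·u′≡0 ⟩
      0F - 0F                 ≡⟨ -‿inverseʳ 0F ⟩
      0F                      ∎

  kernel-removeAt-injective : ∀ {n k} (m u u′ : Vect (suc n)) → m k ≢ 0F → m · u ≡ 0F → m · u′ ≡ 0F →
                              removeAt u k ≗ removeAt u′ k → u ≗ u′
  kernel-removeAt-injective {k = k} m u u′ mk≢0 m·u≡0 m·u′≡0 same = agree⇒≗ uk≡u′k off-k
    where
    off-k : ∀ {j} → k ≢ j → u j ≡ u′ j
    off-k = removeAt-≗⇒agree same
    Δ : Vect _
    Δ j = u j - u′ j
    uk≡u′k : u k ≡ u′ k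
    uk≡u′k = x∙y⁻¹≈ε⇒x≈y (u k) (u′ k) (x≉0∧xy≈0⇒y≈0 mk≢0 (begin
      m k * Δ k  ≡⟨ ·-supported₁ m Δ (x≈y⇒x∙y⁻¹≈ε ∘ off-k) ⟨
      m · Δ      ≡⟨ orthogonal-difference m u u′ m·u≡0 m·u′≡0 ⟩
      0F         ∎))

  kernel-removeAt₂-injective : ∀ {n k l} (m₁ m₂ u u′ : Vect (suc (suc n))) (k≢l : k ≢ l) →
    det₂ (m₁ k) (m₁ l) (m₂ k) (m₂ l) ≢ 0F →
    m₁ · u ≡ 0F → m₁ · u′ ≡ 0F → m₂ · u ≡ 0F → m₂ · u′ ≡ 0F →
    removeAt (removeAt u k) (punchOut k≢l) ≗ removeAt (removeAt u′ k) (punchOut k≢l) → u ≗ u′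
  kernel-removeAt₂-injective {k = k} {l} m₁ m₂ u u′ k≢l det≢0
                             m₁·u≡0 m₁·u′≡0 m₂·u≡0 m₂·u′≡0 same =
    agree⇒≗ (x∙y⁻¹≈ε⇒x≈y (u k) (u′ k) (proj₁ Δk,Δl≡0)) off-k
    where
    off-kl : ∀ {j} → k ≢ j → l ≢ j → u j ≡ u′ j
    off-kl = removeAt₂-≗⇒agree k≢l same
    Δ : Vect _
    Δ j = u j - u′ j
    on-row : ∀ m → m · u ≡ 0F → m · u′ ≡ 0F → m k * Δ k + m l * Δ l ≡ 0F
    on-row m m·u≡0 m·u′≡0 = begin
      m k * Δ k + m l * Δ l  ≡⟨ ·-supported₂ k≢l m Δ (λ k≢j → x≈y⇒x∙y⁻¹≈ε ∘ off-kl k≢j) ⟨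
      m · Δ                  ≡⟨ orthogonal-difference m u u′ m·u≡0 m·u′≡0 ⟩
      0F                     ∎
    Δk,Δl≡0 : Δ k ≡ 0F × Δ l ≡ 0F
    Δk,Δl≡0 = cramer {m₁ k} {m₁ l} {m₂ k} {m₂ l} det≢0
                (on-row m₁ m₁·u≡0 m₁·u′≡0) (on-row m₂ m₂·u≡0 m₂·u′≡0)
    off-k : ∀ {j} → k ≢ j → u j ≡ u′ j
    off-k {j} k≢j with l ≟ j
    ... | yes refl = x∙y⁻¹≈ε⇒x≈y (u l) (u′ l) (proj₂ Δk,Δl≡0)
    ... | no  l≢j  = off-kl k≢j l≢j

  Compatible : ∀ {d} → Mat d → Mat d → Vect d → Vect d → Set
  Compatible A B v u = ∀ n → (n ⊛ A) · u ≡ 0F → ((n ⊛ B) ⊕ v) · u ≡ 0F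

  _∈ker_ : ∀ {d} → Vect d → Mat d → Set
  u ∈ker M = ∀ i → M i · u ≡ 0F

  pencil : ∀ {d} → Mat d → Mat d → 𝔽 p → Mat d
  pencil A B μ i j = B i j - μ * A i j

  module _ {d} (A B : Mat d) (v u : Vect d) (compatible : Compatible A B v u) where

    compatible-affine : ∀ n → n · (A ·ᵣ u) ≡ 0F → n · (B ·ᵣ u) + v · u ≡ 0F
    compatible-affine n n⊥Au = begin
      n · (B ·ᵣ u) + v · u  ≡⟨ cong (_+ v · u) (⊛-·-assoc n B u) ⟨
      (n ⊛ B) · u + v · u   ≡⟨ ·-distribʳ-⊕ (n ⊛ B) v u ⟨
      ((n ⊛ B) ⊕ v) · u     ≡⟨ compatible n (trans (⊛-·-assoc n A u) n⊥Au) ⟩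
      0F                    ∎

    compatible⇒v⊥u : v · u ≡ 0F
    compatible⇒v⊥u = begin
      v · u                          ≡⟨ +-identityˡ (v · u) ⟨
      0F + v · u                     ≡⟨ cong (_+ v · u) (·-zeroˡ (B ·ᵣ u)) ⟨
      (λ _ → 0F) · (B ·ᵣ u) + v · u  ≡⟨ compatible-affine (λ _ → 0F) (·-zeroˡ (A ·ᵣ u)) ⟩
      0F                             ∎

    compatible⇒in-pencil-kernel : ∃ λ μ → u ∈ker pencil A B μ
    compatible⇒in-pencil-kernel with annihilator-⊆⇒proportional (A ·ᵣ u) (B ·ᵣ u) Au⊥⊆Bu⊥
      where
      Au⊥⊆Bu⊥ : ∀ n → n · (A ·ᵣ u) ≡ 0F → n · (B ·ᵣ u) ≡ 0F
      Au⊥⊆Bu⊥ n n⊥Au = begin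
        n · (B ·ᵣ u)          ≡⟨ +-identityʳ _ ⟨
        n · (B ·ᵣ u) + 0F     ≡⟨ cong (n · (B ·ᵣ u) +_) compatible⇒v⊥u ⟨
        n · (B ·ᵣ u) + v · u  ≡⟨ compatible-affine n n⊥Au ⟩
        0F                    ∎
    ... | μ , Bu≡μAu = μ , λ i → begin
      pencil A B μ i · u               ≡⟨ ·-distribʳ-⊖ (B i) (λ j → μ * A i j) u ⟩
      B i · u - (λ j → μ * A i j) · u  ≡⟨ cong (λ t → B i · u - t) (·-scaleˡ μ (A i) u) ⟩
      B i · u - μ * (A i · u)          ≡⟨ cong (λ t → t - μ * (A i · u)) (Bu≡μAu i) ⟩
      μ * (A i · u) - μ * (A i · u)    ≡⟨ -‿inverseʳ _ ⟩
      0F                               ∎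

  record NonzeroMinor {d} (A : Mat d) : Set where
    field
      r₁ r₂ k l : Fin d
      nonzero   : det₂ (A r₁ k) (A r₁ l) (A r₂ k) (A r₂ l) ≢ 0F

    columns-distinct : k ≢ l
    columns-distinct k≡l = nonzero (≡.subst (λ l → det₂ (A r₁ k) (A r₁ l) (A r₂ k) (A r₂ l) ≡ 0F) k≡l
                                             (-‿inverseʳ (A r₁ k * A r₂ k)))

  NonzeroMinor⇒2≤d : ∀ {d} {A : Mat d} → NonzeroMinor A → 2 ≤ d
  NonzeroMinor⇒2≤d {suc zero}    minor = contradiction (Fin1-unique k l) columns-distinct
    where
    open NonzeroMinor minor
    Fin1-unique : (i j : Fin 1) → i ≡ j
    Fin1-unique zero zero = refl
  NonzeroMinor⇒2≤d {suc (suc d)} minor = ℕ.s≤s (ℕ.s≤s ℕ.z≤n)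

  pair-relation : ∀ {r} → 𝔽 p → 𝔽 p → Fin (suc (suc r)) → 𝔽 p
  pair-relation a b zero          = a
  pair-relation a b (suc zero)    = b
  pair-relation a b (suc (suc _)) = 0F

  Σ-pair-relation : ∀ {r} (a b : 𝔽 p) (f : Fin (suc (suc r)) → 𝔽 p) →
                    Σ[ suc (suc r) ] (λ t → pair-relation a b t * f t) ≡ a * f zero + b * f (suc zero)
  Σ-pair-relation a b f = trans (Σ≡sum (λ t → pair-relation a b t * f t)) (sum-pair (λ ()) _ vanishes)
    where
    vanishes : ∀ t → zero ≢ t → suc zero ≢ t → pair-relation a b t * f t ≡ 0F
    vanishes zero          0≢0 _   = contradiction refl 0≢0
    vanishes (suc zero)    _   1≢1 = contradiction refl 1≢1
    vanishes (suc (suc t)) _   _   = zeroˡ (f (suc (suc t)))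

  independent-rows⇒nonzero-minor : ∀ {d r} {A : Mat d} → RankAtLeast (suc (suc r)) A → NonzeroMinor A
  independent-rows⇒nonzero-minor {d} {A = A} (ι , independent) =
    record { r₁ = r₁ ; r₂ = r₂ ; k = k ; l = proj₁ minor≢0 ; nonzero = proj₂ minor≢0 }
    where
    r₁ r₂ : Fin d
    r₁ = ι zero
    r₂ = ι (suc zero)
    trivial-relation : ∀ a b → (∀ j → a * A r₁ j + b * A r₂ j ≡ 0F) → ∀ t → pair-relation a b t ≡ 0F
    trivial-relation a b relation = independent (pair-relation a b) λ j →
      trans (Σ-pair-relation a b (λ t → A (ι t) j)) (relation j)
    zero-row₁⇒1≡0 : (∀ j → A r₁ j ≡ 0F) → 1F ≡ 0F
    zero-row₁⇒1≡0 row₁≡0 = trivial-relation 1F 0F (λ j → begin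
      1F * A r₁ j + 0F * A r₂ j  ≡⟨ cong₂ _+_ (*-identityˡ (A r₁ j)) (zeroˡ (A r₂ j)) ⟩
      A r₁ j + 0F                ≡⟨ +-identityʳ (A r₁ j) ⟩
      A r₁ j                     ≡⟨ row₁≡0 j ⟩
      0F                         ∎) zero
    row₁≢0 : ∃ λ k → A r₁ k ≢ 0F
    row₁≢0 = ¬∀⟶∃¬ d _ (λ j → A r₁ j ≟ 0F) (1F≢0F ∘ zero-row₁⇒1≡0)
    k : Fin d
    k = proj₁ row₁≢0
    zero-minors⇒Ar₁k≡0 : (∀ l → det₂ (A r₁ k) (A r₁ l) (A r₂ k) (A r₂ l) ≡ 0F) → A r₁ k ≡ 0F
    zero-minors⇒Ar₁k≡0 minors≡0 =
      -‿injective (trans (trivial-relation (A r₂ k) (- A r₁ k) relation (suc zero)) (sym -0#≈0#))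
      where
      cofactor-expansion : ∀ a x b y → b * x + (- a) * y ≡ - det₂ a x b y
      cofactor-expansion = solve 4 (λ a x b y → b :* x :+ (:- a) :* y := :- (a :* y :- x :* b)) refl
      relation : ∀ j → A r₂ k * A r₁ j + (- A r₁ k) * A r₂ j ≡ 0F
      relation j = begin
        A r₂ k * A r₁ j + (- A r₁ k) * A r₂ j
          ≡⟨ cofactor-expansion (A r₁ k) (A r₁ j) (A r₂ k) (A r₂ j) ⟩
        - det₂ (A r₁ k) (A r₁ j) (A r₂ k) (A r₂ j)
          ≡⟨ cong -_ (minors≡0 j) ⟩
        - 0F
          ≡⟨ -0#≈0# ⟩
        0F
          ∎
    minor≢0 : ∃ λ l → det₂ (A r₁ k) (A r₁ l) (A r₂ k) (A r₂ l) ≢ 0F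
    minor≢0 = ¬∀⟶∃¬ d _ (λ l → det₂ (A r₁ k) (A r₁ l) (A r₂ k) (A r₂ l) ≟ 0F)
                (proj₂ row₁≢0 ∘ zero-minors⇒Ar₁k≡0)

module PointCounting (p : ℕ) .{{_ : NonZero p}} (prime : Prime p) where
  open Field p
  open PrimeField p prime
  open LinearAlgebra p prime
  open CommutativeRing commutativeRing using (_*_)
  open import Algebra.Properties.Ring (CommutativeRing.ring commutativeRing) using (x∙y⁻¹≈ε⇒x≈y)
  open ≡ using (refl)

  length≤-in-hyperplane : ∀ {n} (v : Vect (suc n)) {W : List (Vec (𝔽 p) (suc n))} {i} → v i ≢ 0F →
    Unique W → (∀ {w} → w ∈ W → v · lookup w ≡ 0F) → length W ≤ p ^ n
  length≤-in-hyperplane v {i = i} vi≢0 W-unique W⊆v⊥ =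
    length≤-by-encoding W-unique W⊆v⊥ code code-injective
    where
    code : ∀ w → v · lookup w ≡ 0F → Fin _
    code w _ = Fin.funToFin (removeAt (lookup w) i)
    code-injective : ∀ {w w′} (v⊥w : v · lookup w ≡ 0F) (v⊥w′ : v · lookup w′ ≡ 0F) →
                     code w v⊥w ≡ code w′ v⊥w′ → w ≡ w′
    code-injective {w} {w′} v⊥w v⊥w′ same-code = lookup-≗⇒≡
      (kernel-removeAt-injective v (lookup w) (lookup w′) vi≢0 v⊥w v⊥w′ (funToFin-injective same-code))

  large-⊆-hyperplane⇒v≡0 : ∀ {n} (v : Vect (suc n)) {W : List (Vec (𝔽 p) (suc n))} →
    Unique W → (∀ {w} → w ∈ W → v · lookup w ≡ 0F) → ¬ length W ≤ p ^ n → ∀ i → v i ≡ 0F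
  large-⊆-hyperplane⇒v≡0 {n} v W-unique W⊆v⊥ W-large with all? (λ i → v i ≟ 0F)
  ... | yes v≡0 = v≡0
  ... | no  v≢0 with ¬∀⟶∃¬ (suc n) _ (λ i → v i ≟ 0F) v≢0
  ...   | i , vi≢0 = contradiction (length≤-in-hyperplane v vi≢0 W-unique W⊆v⊥) W-large

  module PencilKernels {n} (A B : Mat (suc (suc n))) (minor : NonzeroMinor A)
    (not-multiple : ∀ c → ¬ (∀ i j → B i j ≡ c * A i j)) where
    open NonzeroMinor minor

    pencil-minor : 𝔽 p → 𝔽 p
    pencil-minor μ = det₂ (pencil A B μ r₁ k) (pencil A B μ r₁ l) (pencil A B μ r₂ k) (pencil A B μ r₂ l)

    no-three-roots : ∀ {μ₁ μ₂ μ₃} → μ₁ Fin.< μ₂ → μ₂ Fin.< μ₃ →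
                     pencil-minor μ₁ ≡ 0F → pencil-minor μ₂ ≡ 0F → pencil-minor μ₃ ≢ 0F
    no-three-roots μ₁<μ₂ μ₂<μ₃ =
      pencil-minor-root-bound {A r₁ k} {A r₁ l} {A r₂ k} {A r₂ l} {B r₁ k} {B r₁ l} {B r₂ k} {B r₂ l}
        nonzero (Fin.<⇒≢ μ₁<μ₂) (Fin.<⇒≢ (Fin.<-trans μ₁<μ₂ μ₂<μ₃)) (Fin.<⇒≢ μ₂<μ₃)

    nonzero-entry : ∀ μ → ∃ λ i → ∃ λ j → pencil A B μ i j ≢ 0F
    nonzero-entry μ with ¬∀⟶∃¬ _ _ (λ i → all? (λ j → B i j ≟ μ * A i j)) (not-multiple μ)
    ... | i , row-not-multiple with ¬∀⟶∃¬ _ _ (λ j → B i j ≟ μ * A i j) row-not-multiple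
    ...   | j , Bij≢μAij = i , j , Bij≢μAij ∘ x∙y⁻¹≈ε⇒x≈y (B i j) (μ * A i j)

    row column : 𝔽 p → Fin (suc (suc n))
    row μ    = proj₁ (nonzero-entry μ)
    column μ = proj₁ (proj₂ (nonzero-entry μ))

    SmallerRoot : 𝔽 p → Set
    SmallerRoot μ = ∃ λ ν → ν Fin.< μ × pencil-minor ν ≡ 0F

    data Class (μ : 𝔽 p) : Set where
      regular     : pencil-minor μ ≢ 0F → Class μ
      first-root  : pencil-minor μ ≡ 0F → ¬ SmallerRoot μ → Class μ
      second-root : pencil-minor μ ≡ 0F → SmallerRoot μ → Class μ

    classify : ∀ μ → Class μ
    classify μ with pencil-minor μ ≟ 0F | any? (λ ν → ν Fin.<? μ ×-dec pencil-minor ν ≟ 0F)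
    ... | no  μ-regular | _           = regular μ-regular
    ... | yes μ-root    | no  ∄ν      = first-root μ-root ∄ν
    ... | yes μ-root    | yes smaller = second-root μ-root smaller

    tag : ∀ {μ} → Class μ → Fin 3
    tag (regular _)       = zero
    tag (first-root _ _)  = suc zero
    tag (second-root _ _) = suc (suc zero)

    payload : ∀ {μ} → Class μ → Vect (suc (suc n)) → Vect (suc n)
    payload {μ} (regular _)       u = μ Vector.∷ removeAt (removeAt u k) (punchOut columns-distinct)
    payload {μ} (first-root _ _)  u = removeAt u (column μ)
    payload {μ} (second-root _ _) u = removeAt u (column μ)

    same-tag⇒same-μ : ∀ {μ μ′ u u′} (c : Class μ) (c′ : Class μ′) → tag c ≡ tag c′ →
                      payload c u ≗ payload c′ u′ → μ ≡ μ′
    same-tag⇒same-μ (regular _) (regular _) _ same = same zero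
    same-tag⇒same-μ {μ} {μ′} (first-root μ-root ∄ν) (first-root μ′-root ∄ν′) _ _ with Fin.<-cmp μ μ′
    ... | tri< μ<μ′ _ _ = contradiction (μ , μ<μ′ , μ-root) ∄ν′
    ... | tri≈ _ μ≡μ′ _ = μ≡μ′
    ... | tri> _ _ μ′<μ = contradiction (μ′ , μ′<μ , μ′-root) ∄ν
    same-tag⇒same-μ {μ} {μ′} (second-root μ-root (ν , ν<μ , ν-root))
                             (second-root μ′-root (ν′ , ν′<μ′ , ν′-root)) _ _ with Fin.<-cmp μ μ′
    ... | tri< μ<μ′ _ _ = contradiction μ′-root (no-three-roots ν<μ μ<μ′ ν-root μ-root)
    ... | tri≈ _ μ≡μ′ _ = μ≡μ′
    ... | tri> _ _ μ′<μ = contradiction μ-root (no-three-roots ν′<μ′ μ′<μ ν′-root μ′-root)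
    same-tag⇒same-μ (regular _)       (first-root _ _)  () _
    same-tag⇒same-μ (regular _)       (second-root _ _) () _
    same-tag⇒same-μ (first-root _ _)  (regular _)       () _
    same-tag⇒same-μ (first-root _ _)  (second-root _ _) () _
    same-tag⇒same-μ (second-root _ _) (regular _)       () _
    same-tag⇒same-μ (second-root _ _) (first-root _ _)  () _

    determined-by-nonzero-entry : ∀ {μ u u′} → u ∈ker pencil A B μ → u′ ∈ker pencil A B μ →
                                  removeAt u (column μ) ≗ removeAt u′ (column μ) → u ≗ u′
    determined-by-nonzero-entry {μ} {u} {u′} u∈ker u′∈ker =
      kernel-removeAt-injective {k = column μ} (pencil A B μ (row μ)) u u′ (proj₂ (proj₂ (nonzero-entry μ)))
        (u∈ker (row μ)) (u′∈ker (row μ))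

    payload-injective : ∀ {μ u u′} (c : Class μ) → u ∈ker pencil A B μ → u′ ∈ker pencil A B μ →
                        payload c u ≗ payload c u′ → u ≗ u′
    payload-injective {μ} {u} {u′} (regular μ-regular) u∈ker u′∈ker same =
      kernel-removeAt₂-injective {k = k} {l} (pencil A B μ r₁) (pencil A B μ r₂) u u′ columns-distinct
        μ-regular (u∈ker r₁) (u′∈ker r₁) (u∈ker r₂) (u′∈ker r₂) (same ∘ suc)
    payload-injective {μ} {u} {u′} (first-root _ _)  = determined-by-nonzero-entry {μ} {u} {u′}
    payload-injective {μ} {u} {u′} (second-root _ _) = determined-by-nonzero-entry {μ} {u} {u′}

    code : ∀ w → ∃ (λ μ → lookup w ∈ker pencil A B μ) → Fin (3 ℕ.* p ^ suc n)
    code w (μ , _) = Fin.combine (tag (classify μ)) (Fin.funToFin (payload (classify μ) (lookup w)))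

    code-injective : ∀ {w w′} (w∈ker : ∃ λ μ → lookup w ∈ker pencil A B μ)
                     (w′∈ker : ∃ λ μ → lookup w′ ∈ker pencil A B μ) →
                     code w w∈ker ≡ code w′ w′∈ker → w ≡ w′
    code-injective {w} {w′} (μ , w∈ker) (μ′ , w′∈ker) same-code
      with combine-injective (tag (classify μ)) (Fin.funToFin (payload (classify μ) (lookup w)))
                             (tag (classify μ′)) (Fin.funToFin (payload (classify μ′) (lookup w′))) same-code
    ... | same-tag , same-payload
      with same-tag⇒same-μ {μ} {μ′} {lookup w} {lookup w′} (classify μ) (classify μ′) same-tag
                             (funToFin-injective same-payload)
    ... | refl = lookup-≗⇒≡ (payload-injective {μ} {lookup w} {lookup w′} (classify μ) w∈ker w′∈ker
                                (funToFin-injective same-payload))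

  length≤-in-pencil-kernels : ∀ {n} (A B : Mat (suc (suc n))) {W : List (Vec (𝔽 p) (suc (suc n)))} →
    NonzeroMinor A → (∀ c → ¬ (∀ i j → B i j ≡ c * A i j)) →
    Unique W → (∀ {w} → w ∈ W → ∃ λ μ → lookup w ∈ker pencil A B μ) → length W ≤ 3 ℕ.* p ^ suc n
  length≤-in-pencil-kernels A B minor not-multiple W-unique W⊆kernels =
    length≤-by-encoding W-unique W⊆kernels code code-injective
    where open PencilKernels A B minor not-multiple

  large-⊆-pencil-kernels⇒B≡cA : ∀ {n} (A B : Mat (suc (suc n))) {W : List (Vec (𝔽 p) (suc (suc n)))} →
    NonzeroMinor A → Unique W → (∀ {w} → w ∈ W → ∃ λ μ → lookup w ∈ker pencil A B μ) →
    ¬ length W ≤ 3 ℕ.* p ^ suc n → ∃ λ c → ∀ i j → B i j ≡ c * A i j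
  large-⊆-pencil-kernels⇒B≡cA A B minor W-unique W⊆kernels W-large
    with any? (λ c → all? (λ i → all? (λ j → B i j ≟ c * A i j)))
  ... | yes B≡cA = B≡cA
  ... | no  ∄c   = contradiction
    (length≤-in-pencil-kernels A B minor (λ c B≡cA → ∄c (c , B≡cA)) W-unique W⊆kernels) W-large

module Density where
  open import Data.Integer as ℤ using (+_)
  import Data.Integer.Properties as ℤ
  import Data.Nat.Coprimality as Coprimality
  open import Data.Rational using (mkℚ; 1ℚ; Positive; NonNegative; positive)
  open import Data.Rational.Properties
    using ( normalize-coprime; ≤-refl; ≤-trans; ≤-reflexive; ≤-<-trans; <-irrefl; *-assoc
          ; *-identityˡ; *-identityʳ; *-monoˡ-≤-nonNeg; *-monoʳ-≤-nonNeg; *-cancelʳ-≤-pos; pos⇒nonNeg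
          ; module ≤-Reasoning )

  ⟦⟧≡mkℚ : ∀ n → ⟦ n ⟧ ≡ mkℚ (+ n) 0 (Coprimality.sym (Coprimality.1-coprimeTo n))
  ⟦⟧≡mkℚ n = normalize-coprime (Coprimality.sym (Coprimality.1-coprimeTo n))

  ⟦⟧-* : ∀ a b → ⟦ a ℕ.* b ⟧ ≡ ⟦ a ⟧ ℚ.* ⟦ b ⟧
  ⟦⟧-* a b rewrite ⟦⟧≡mkℚ a | ⟦⟧≡mkℚ b = ≡.cong (ℚ._/ 1) (≡.sym (ℤ.+◃n≡+n (a ℕ.* b)))

  ⟦⟧-mono-≤ : ∀ {a b} → a ≤ b → ⟦ a ⟧ ℚ.≤ ⟦ b ⟧
  ⟦⟧-mono-≤ {a} {b} a≤b rewrite ⟦⟧≡mkℚ a | ⟦⟧≡mkℚ b =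
    ℚ.*≤* (ℤ.*-monoʳ-≤-nonNeg (+ 1) (ℤ.+≤+ a≤b))

  ⟦⟧-mono-< : ∀ {a b} → a ℕ.< b → ⟦ a ⟧ ℚ.< ⟦ b ⟧
  ⟦⟧-mono-< {a} {b} a<b rewrite ⟦⟧≡mkℚ a | ⟦⟧≡mkℚ b =
    ℚ.*<* (ℤ.*-monoʳ-<-pos (+ 1) (ℤ.+<+ a<b))

  ^ℚ-≤1 : ∀ {δ} .{{_ : NonNegative δ}} → δ ℚ.≤ 1ℚ → ∀ k → δ ^ℚ k ℚ.≤ 1ℚ
  ^ℚ-≤1 δ≤1 zero = ≤-refl
  ^ℚ-≤1 {δ} δ≤1 (suc k) =
    ≤-trans (*-monoˡ-≤-nonNeg δ (^ℚ-≤1 δ≤1 k)) (≤-trans (≤-reflexive (*-identityʳ δ)) δ≤1)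

  dense⇒not-sparse : ∀ {δ p m L} → 0ℚ ℚ.< δ → 0 ℕ.< p → ⟦ 4 ⟧ ℚ.≤ (δ ^ℚ 4) ℚ.* ⟦ p ⟧ →
    δ ℚ.* ⟦ p ^ suc m ⟧ ℚ.≤ ⟦ L ⟧ → L ≤ p ^ suc m → ¬ L ≤ 3 ℕ.* p ^ m
  dense⇒not-sparse {δ} {p} {m} {L} δ>0 p>0 p-large dense L≤pᵐ⁺¹ L≤3pᵐ =
    <-irrefl ≡.refl (≤-<-trans 4≤3 (⟦⟧-mono-< (ℕ.n<1+n 3)))
    where
    open ≤-Reasoning
    instance
      δ-positive : Positive δ
      δ-positive = positive δ>0
      δ-nonNegative : NonNegative δ
      δ-nonNegative = pos⇒nonNeg δ
      p-nonNegative : NonNegative ⟦ p ⟧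
      p-nonNegative = pos⇒nonNeg ⟦ p ⟧ {{positive (⟦⟧-mono-< p>0)}}
      pᵐ-positive : Positive ⟦ p ^ m ⟧
      pᵐ-positive = positive (⟦⟧-mono-< (ℕ.m^n>0 p {{ℕ.>-nonZero p>0}} m))
      pᵐ⁺¹-positive : Positive ⟦ p ^ suc m ⟧
      pᵐ⁺¹-positive = positive (⟦⟧-mono-< (ℕ.m^n>0 p {{ℕ.>-nonZero p>0}} (suc m)))
    δ≤1 : δ ℚ.≤ 1ℚ
    δ≤1 = *-cancelʳ-≤-pos ⟦ p ^ suc m ⟧ (begin
      δ ℚ.* ⟦ p ^ suc m ⟧   ≤⟨ dense ⟩
      ⟦ L ⟧                 ≤⟨ ⟦⟧-mono-≤ L≤pᵐ⁺¹ ⟩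
      ⟦ p ^ suc m ⟧         ≡⟨ *-identityˡ ⟦ p ^ suc m ⟧ ⟨
      1ℚ ℚ.* ⟦ p ^ suc m ⟧  ∎)
    δ⁴≤δ : δ ^ℚ 4 ℚ.≤ δ
    δ⁴≤δ = ≤-trans (*-monoˡ-≤-nonNeg δ (^ℚ-≤1 δ≤1 3)) (≤-reflexive (*-identityʳ δ))
    δp≤3 : δ ℚ.* ⟦ p ⟧ ℚ.≤ ⟦ 3 ⟧
    δp≤3 = *-cancelʳ-≤-pos ⟦ p ^ m ⟧ (begin
      δ ℚ.* ⟦ p ⟧ ℚ.* ⟦ p ^ m ⟧    ≡⟨ *-assoc δ ⟦ p ⟧ ⟦ p ^ m ⟧ ⟩
      δ ℚ.* (⟦ p ⟧ ℚ.* ⟦ p ^ m ⟧)  ≡⟨ ≡.cong (δ ℚ.*_) (⟦⟧-* p (p ^ m)) ⟨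
      δ ℚ.* ⟦ p ^ suc m ⟧          ≤⟨ dense ⟩
      ⟦ L ⟧                        ≤⟨ ⟦⟧-mono-≤ L≤3pᵐ ⟩
      ⟦ 3 ℕ.* p ^ m ⟧              ≡⟨ ⟦⟧-* 3 (p ^ m) ⟩
      ⟦ 3 ⟧ ℚ.* ⟦ p ^ m ⟧          ∎)
    4≤3 : ⟦ 4 ⟧ ℚ.≤ ⟦ 3 ⟧
    4≤3 = begin
      ⟦ 4 ⟧             ≤⟨ p-large ⟩
      δ ^ℚ 4 ℚ.* ⟦ p ⟧  ≤⟨ *-monoʳ-≤-nonNeg ⟦ p ⟧ δ⁴≤δ ⟩
      δ ℚ.* ⟦ p ⟧       ≤⟨ δp≤3 ⟩
      ⟦ 3 ⟧             ∎

proposition6p12 :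
    (d : ℕ) → 1 ≤ d →
    ∃[ K ] ((δ : ℚ) → 0ℚ ℚ.< δ →
      (p : ℕ) .{{_ : NonZero p}} → Prime p →
      ⟦ K ⟧ ℚ.≤ (δ ^ℚ K) ℚ.* ⟦ p ⟧ →
      let open Field p in
      (A : Mat d) → RankAtLeast 3 A →
      (B : Mat d) (v : Vect d) (W : List (Vec (𝔽 p) d)) → Unique W →
      δ ℚ.* ⟦ p ^ d ⟧ ℚ.≤ ⟦ length W ⟧ →
      ((w : Vec (𝔽 p) d) → w ∈ W → (n : Vect d) →
        (n ⊛ A) · lookup w ≡ 0F → ((n ⊛ B) ⊕ v) · lookup w ≡ 0F) →
      ((i : Fin d) → v i ≡ 0F) ×
      (Σ (𝔽 p) λ c → (i j : Fin d) → B i j ≡ c *F A i j))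
proposition6p12 (suc zero) _ = 4 , λ _ _ p prime _ A rank _ _ _ _ _ _ →
  let open LinearAlgebra p prime
  in  contradiction (NonzeroMinor⇒2≤d (independent-rows⇒nonzero-minor {A = A} rank)) λ { (ℕ.s≤s ()) }
proposition6p12 (suc (suc n)) _ = 4 , λ δ δ>0 p prime p-large A rank B v W W-unique W-dense compatible →
  let open LinearAlgebra p prime
      open PointCounting p prime
      W-large : ¬ length W ≤ 3 ℕ.* p ^ suc n
      W-large = Density.dense⇒not-sparse {m = suc n} δ>0 (ℕ.>-nonZero⁻¹ p) p-large W-dense
                  (length≤-of-vectors W-unique)
  in  large-⊆-hyperplane⇒v≡0 v W-unique (λ {w} w∈W → compatible⇒v⊥u A B v (lookup w) (compatible w w∈W))
        (λ W≤pⁿ⁺¹ → W-large (ℕ.≤-trans W≤pⁿ⁺¹ (ℕ.m≤n*m (p ^ suc n) 3)))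
    , large-⊆-pencil-kernels⇒B≡cA A B (independent-rows⇒nonzero-minor {A = A} rank) W-unique
        (λ {w} w∈W → compatible⇒in-pencil-kernel A B v (lookup w) (compatible w w∈W)) W-large
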